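{- Let $\sigma\in S_n$ and let $A,B$ be disjoint $k$-sets with $\sigma_{\langle A\rangle}=\sigma_{\langle B\rangle}$; consider the chain graph of $\sigma$ for $A$ and $B$. If $C$ is an increasing chain and $C'$ is a decreasing chain, then $C$ and $C'$ cannot overlap both horizontally and vertically. Consequently, an edge of an increasing chain $C$ cannot be cut both horizontally and vertically by points of a decreasing chain $C'$.
   Context: $S_n$ is the set of permutations of $[n]$. Points of $\sigma$ are $(i,\sigma(i))$, identified with positions $i$ and ordered left to right. For $A\subset[n]$, $\sigma_{\langle A\rangle}$ is the permutation in the same relative order as the word obtained by deleting the entries at positions in $A$; if $[n]\setminus A=\{i_1<\dots<i_r\}$, the $i_j$th entry of $\sigma$ fulfills the $j$th entry of $\sigma_{\langle A\rangle}$. For disjoint $k$-sets $A,B$ with $\sigma_{\langle A\rangle}=\sigma_{\langle B\rangle}$, the chain graph has vertex set the points of $\sigma$; for each $i\in[n-k]$ an edge joins the point fulfilling the $i$th entry of $\sigma_{\langle A\rangle}$ and the point fulfilling the $i$th entry of $\sigma_{\langle B\rangle}$ when these differ. The chains are the connected components with at least one edge; each is a path. A chain is increasing if every edge $pp'$ with $p$ left of $p'$ has $\sigma(p)<\sigma(p')$, decreasing if every such edge has $\sigma(p)>\sigma(p')$. Chains $C,C'$ with left end-vertices $\ell,\ell'$ and right end-vertices $r,r'$ overlap horizontally if $\ell<r'$ and $\ell'<r$; with lower end-vertices $b,b'$ and upper end-vertices $t,t'$ they overlap vertically if $\sigma(b)<\sigma(t')$ and $\sigma(b')<\sigma(t)$.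 For distinct points $p,p'$, a point $q$ cuts $pp'$ horizontally if its value lies strictly between $\sigma(p),\sigma(p')$, and vertically if its position lies strictly between the positions of $p,p'$ (a point with both properties cuts both horizontally and vertically). -}

module Defs where

open import Data.Nat using (ℕ; _<_; _<?_)
open import Data.Fin using (Fin; toℕ)
open import Data.Fin.Subset using (Subset; _∈_; _∉_)
open import Data.Fin.Subset.Properties using (_∈?_)
open import Data.Fin.Permutation using (Permutation′; _⟨$⟩ʳ_)
open import Data.List using (List; map; filter; length; zip; allFin)
open import Data.List.Membership.Propositional using () renaming (_∈_ to _∈ₗ_)
open import Data.Product using (_×_; _,_; ∃-syntax)
open import Data.Sum using (_⊎_)
open import Relation.Nullary using (¬_; ¬?)
open import Relation.Binary.PropositionalEquality using (_≡_; _≢_)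
open import Relation.Binary.Construct.Closure.ReflexiveTransitive using (Star)

val : ∀ {n} → Permutation′ n → Fin n → ℕ
val σ i = toℕ (σ ⟨$⟩ʳ i)

-- positions NOT in A, in increasing order: i₁ < … < i_r.
-- The j-th element of this list is the point fulfilling the j-th entry of σ⟨A⟩.
kept : ∀ {n} → Subset n → List (Fin n)
kept {n} A = filter (λ i → ¬? (i ∈? A)) (allFin n)

standardise : List ℕ → List ℕ
standardise w = map (λ x → length (filter (_<? x) w)) w

-- σ⟨A⟩ : the pattern obtained by deleting the entries at positions in A
-- (as a 0-based one-line word)
reduced : ∀ {n} → Permutation′ n → Subset n → List ℕ
reduced σ A = standardise (map (val σ) (kept A))

Disjoint : ∀ {n} → Subset n → Subset n → Set
Disjoint A B = ∀ i → i ∈ A → i ∉ B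

-- pairs (point fulfilling the i-th entry of σ⟨A⟩ , point fulfilling the i-th entry of σ⟨B⟩)
fulfilPairs : ∀ {n} → Subset n → Subset n → List (Fin n × Fin n)
fulfilPairs A B = zip (kept A) (kept B)

Edge : ∀ {n} → Subset n → Subset n → Fin n → Fin n → Set
Edge A B p q = p ≢ q × ((p , q) ∈ₗ fulfilPairs A B ⊎ (q , p) ∈ₗ fulfilPairs A B)

Connected : ∀ {n} → Subset n → Subset n → Fin n → Fin n → Set
Connected A B = Star (Edge A B)

-- v is incident to at least one edge (so its component is a chain)
HasEdge : ∀ {n} → Subset n → Subset n → Fin n → Set
HasEdge A B v = ∃[ q ] Edge A B v q

-- The chain C(v) is the component containing v; p is a point of it
InChain : ∀ {n} → Subset n → Subset n → Fin n → Fin n → Set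
InChain A B v p = Connected A B v p

EndVertex : ∀ {n} → Subset n → Subset n → Fin n → Fin n → Set
EndVertex A B v p = InChain A B v p × ∃[ q ] (Edge A B p q × (∀ q′ → Edge A B p q′ → q′ ≡ q))

Increasing : ∀ {n} → Permutation′ n → Subset n → Subset n → Fin n → Set
Increasing σ A B v = ∀ p p′ → InChain A B v p → InChain A B v p′ → Edge A B p p′ →
  toℕ p < toℕ p′ → val σ p < val σ p′

Decreasing : ∀ {n} → Permutation′ n → Subset n → Subset n → Fin n → Set
Decreasing σ A B v = ∀ p p′ → InChain A B v p → InChain A B v p′ → Edge A B p p′ →
  toℕ p < toℕ p′ → val σ p′ < val σ p

OverlapH : ∀ {n} → (ℓ r ℓ′ r′ : Fin n) → Set
OverlapH ℓ r ℓ′ r′ = toℕ ℓ < toℕ r′ × toℕ ℓ′ < toℕ r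

OverlapV : ∀ {n} → Permutation′ n → (b t b′ t′ : Fin n) → Set
OverlapV σ b t b′ t′ = val σ b < val σ t′ × val σ b′ < val σ t

CutsH : ∀ {n} → Permutation′ n → (p p′ q : Fin n) → Set
CutsH σ p p′ q = (val σ p < val σ q × val σ q < val σ p′) ⊎ (val σ p′ < val σ q × val σ q < val σ p)

CutsV : ∀ {n} → (p p′ q : Fin n) → Set
CutsV p p′ q = (toℕ p < toℕ q × toℕ q < toℕ p′) ⊎ (toℕ p′ < toℕ q × toℕ q < toℕ p)

-- Orient every edge of the chain graph from the point fulfilling the i-th entry of σ⟨A⟩ to
-- the point fulfilling the i-th entry of σ⟨B⟩, and fix a threshold c on positions or on values.
-- Kept and deleted points below c together make up all points below c, for A as for B, and
-- the kept ones of A and of B have the same relative order; so an arc leaving the region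
-- below c forces more deleted points of B than of A below c, and all arcs crossing c cross it
-- in the same direction. The matching of the two sides preserves positions, so all arcs of a
-- chain point the same way horizontally; on an increasing chain they go right iff they go
-- up, on a decreasing chain iff they go down. Chains overlapping horizontally and vertically
-- both cross a common position threshold and a common value threshold, so they would have
-- to agree in both directions, which is impossible. An edge of C cut horizontally and
-- vertically by points of C′ gives such common thresholds at the cutting points.

module Submission where

open import Defs
open import Data.Bool using (Bool; not)
open import Data.Bool.Properties using (not-¬)
open import Data.Empty using (⊥)
open import Data.Fin using (Fin; toℕ)
open import Data.Fin.Properties using (toℕ-injective)
open import Data.Fin.Subset using (Subset; ∣_∣)
open import Data.Fin.Subset.Properties using (_∈?_)
open import Data.Fin.Permutation using (Permutation′)
open import Data.List using (List; []; _∷_; map; filter; length; zip; allFin)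
open import Data.List.Membership.Propositional using () renaming (_∈_ to _∈ₗ_)
open import Data.List.Membership.Propositional.Properties using (∈-map⁺)
open import Data.List.Properties using (filter-accept; filter-reject; filter-none; map-∘; ∷-injectiveˡ; ∷-injectiveʳ)
open import Data.List.Relation.Unary.All as All using (All; []; _∷_)
open import Data.List.Relation.Unary.All.Properties using (map⁺)
open import Data.List.Relation.Unary.AllPairs using (AllPairs; []; _∷_)
import Data.List.Relation.Unary.AllPairs.Properties as AllPairs
open import Data.List.Relation.Unary.Any using (here; there)
open import Data.Nat using (ℕ; suc; _<_; _≤_; _<?_; _≤?_; z≤n; s≤s; _⊔_; _+_)
open import Data.Nat.Properties
open import Data.Product using (_×_; _,_; proj₁; proj₂; Σ)
open import Data.Sum using (_⊎_; inj₁; inj₂)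
import Data.Sum as Sum
open import Function using (_∘_; _⇔_; mk⇔; Equivalence)
open import Function.Definitions using (Injective)
open import Function.Bundles using (Injection)
open import Function.Properties.Inverse using (↔⇒↣)
open import Relation.Binary using (tri<; tri≈; tri>)
open import Relation.Binary.Construct.Closure.ReflexiveTransitive using (Star; ε; _◅_; _◅◅_; reverse)
open import Relation.Binary.PropositionalEquality
open import Relation.Nullary using (¬_; Dec; yes; no; ¬?; does; contradiction)
open import Relation.Nullary.Decidable using (dec-true; dec-false; does-⇔)
open import Relation.Unary using (Pred; Decidable)
open import Level using (0ℓ)

countBelow : ℕ → List ℕ → ℕ
countBelow c xs = length (filter (_<? c) xs)

countBelow-∷-< : ∀ {c x} xs → x < c → countBelow c (x ∷ xs) ≡ suc (countBelow c xs)
countBelow-∷-< {c} xs x<c = cong length (filter-accept (_<? c) x<c)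

countBelow-∷-≮ : ∀ {c x} xs → ¬ x < c → countBelow c (x ∷ xs) ≡ countBelow c xs
countBelow-∷-≮ {c} xs x≮c = cong length (filter-reject (_<? c) x≮c)

countBelow-none : ∀ {c} xs → All (c ≤_) xs → countBelow c xs ≡ 0
countBelow-none {c} xs c≤xs = cong length (filter-none (_<? c) (All.map ≤⇒≯ c≤xs))

countBelow-mono : ∀ xs {s t} → s ≤ t → countBelow s xs ≤ countBelow t xs
countBelow-mono [] _ = z≤n
countBelow-mono (x ∷ xs) {s} {t} s≤t = by-cases (x <? s) (x <? t)
  where
  by-cases : Dec (x < s) → Dec (x < t) → countBelow s (x ∷ xs) ≤ countBelow t (x ∷ xs)
  by-cases (yes x<s) (yes x<t) rewrite countBelow-∷-< xs x<s | countBelow-∷-< xs x<t =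
    s≤s (countBelow-mono xs s≤t)
  by-cases (yes x<s) (no x≮t) = contradiction (<-≤-trans x<s s≤t) x≮t
  by-cases (no x≮s) (yes x<t) rewrite countBelow-∷-≮ xs x≮s | countBelow-∷-< xs x<t =
    m≤n⇒m≤1+n (countBelow-mono xs s≤t)
  by-cases (no x≮s) (no x≮t) rewrite countBelow-∷-≮ xs x≮s | countBelow-∷-≮ xs x≮t =
    countBelow-mono xs s≤t

countBelow-mono-< : ∀ xs {s t} → s < t → s ∈ₗ xs → countBelow s xs < countBelow t xs
countBelow-mono-< (s ∷ xs) s<t (here refl) =
  subst₂ _<_ (sym (countBelow-∷-≮ xs (<-irrefl refl))) (sym (countBelow-∷-< xs s<t))
    (s≤s (countBelow-mono xs (<⇒≤ s<t)))
countBelow-mono-< (x ∷ xs) {s} {t} s<t (there s∈xs) = by-cases (x <? s) (x <? t)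
  where
  by-cases : Dec (x < s) → Dec (x < t) → countBelow s (x ∷ xs) < countBelow t (x ∷ xs)
  by-cases (yes x<s) (yes x<t) rewrite countBelow-∷-< xs x<s | countBelow-∷-< xs x<t =
    s≤s (countBelow-mono-< xs s<t s∈xs)
  by-cases (yes x<s) (no x≮t) = contradiction (<-trans x<s s<t) x≮t
  by-cases (no x≮s) (yes x<t) rewrite countBelow-∷-≮ xs x≮s | countBelow-∷-< xs x<t =
    m<n⇒m<1+n (countBelow-mono-< xs s<t s∈xs)
  by-cases (no x≮s) (no x≮t) rewrite countBelow-∷-≮ xs x≮s | countBelow-∷-≮ xs x≮t =
    countBelow-mono-< xs s<t s∈xs

countBelow-∷-+ˡ : ∀ {c} x {k ys zs} → countBelow c ys + k ≡ countBelow c zs →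
  countBelow c (x ∷ ys) + k ≡ countBelow c (x ∷ zs)
countBelow-∷-+ˡ {c} x {k} {ys} {zs} eq = by-cases (x <? c)
  where
  by-cases : Dec (x < c) → countBelow c (x ∷ ys) + k ≡ countBelow c (x ∷ zs)
  by-cases (yes x<c) rewrite countBelow-∷-< ys x<c | countBelow-∷-< zs x<c = cong suc eq
  by-cases (no x≮c) rewrite countBelow-∷-≮ ys x≮c | countBelow-∷-≮ zs x≮c = eq

countBelow-∷-+ʳ : ∀ {c} x {k ys zs} → k + countBelow c ys ≡ countBelow c zs →
  k + countBelow c (x ∷ ys) ≡ countBelow c (x ∷ zs)
countBelow-∷-+ʳ {c} x {k} eq =
  trans (+-comm k _) (countBelow-∷-+ˡ {c} x (trans (+-comm _ k) eq))

countBelow-filter-split : ∀ {X : Set} {P : Pred X 0ℓ} (P? : Decidable P) (f : X → ℕ) c xs →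
  countBelow c (map f (filter (¬? ∘ P?) xs)) + countBelow c (map f (filter P? xs))
    ≡ countBelow c (map f xs)
countBelow-filter-split P? f c [] = refl
countBelow-filter-split P? f c (x ∷ xs) with P? x
... | yes _ = countBelow-∷-+ʳ {c} (f x) (countBelow-filter-split P? f c xs)
... | no _  = countBelow-∷-+ˡ {c} (f x) (countBelow-filter-split P? f c xs)

module _ {X Y : Set} where

  ∈-zip⁻ˡ : ∀ {xs : List X} {ys : List Y} {x y} → (x , y) ∈ₗ zip xs ys → x ∈ₗ xs
  ∈-zip⁻ˡ {_ ∷ _} {_ ∷ _} (here refl) = here refl
  ∈-zip⁻ˡ {_ ∷ _} {_ ∷ _} (there m)   = there (∈-zip⁻ˡ m)

  ∈-zip⁻ʳ : ∀ {xs : List X} {ys : List Y} {x y} → (x , y) ∈ₗ zip xs ys → y ∈ₗ ys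
  ∈-zip⁻ʳ {_ ∷ _} {_ ∷ _} (here refl) = here refl
  ∈-zip⁻ʳ {_ ∷ _} {_ ∷ _} (there m)   = there (∈-zip⁻ʳ m)

  map-≡⇒zip-≡ : ∀ {Z : Set} {g : X → Z} {h : Y → Z} {xs ys x y} →
    map g xs ≡ map h ys → (x , y) ∈ₗ zip xs ys → g x ≡ h y
  map-≡⇒zip-≡ {xs = _ ∷ _} {_ ∷ _} eq (here refl) = ∷-injectiveˡ eq
  map-≡⇒zip-≡ {xs = _ ∷ _} {_ ∷ _} eq (there m)   = map-≡⇒zip-≡ (∷-injectiveʳ eq) m

module _ {X : Set} (f : X → ℕ) where

  rank : List X → X → ℕ
  rank xs x = countBelow (f x) (map f xs)

  rank-<-transfer : ∀ {xs ys x y x′ y′} → rank xs x ≡ rank ys y → rank xs x′ ≡ rank ys y′ →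
    x ∈ₗ xs → f x < f x′ → f y < f y′
  rank-<-transfer {xs} {ys} {x} {y} {x′} {y′} r≡ r≡′ x∈xs fx<fx′ with f y′ ≤? f y
  ... | no fy′≰fy = ≰⇒> fy′≰fy
  ... | yes fy′≤fy = contradiction (countBelow-mono (map f ys) fy′≤fy) (<⇒≱ (begin-strict
    countBelow (f y) (map f ys)    ≡⟨ r≡ ⟨
    rank xs x                      <⟨ countBelow-mono-< (map f xs) fx<fx′ (∈-map⁺ f x∈xs) ⟩
    rank xs x′                     ≡⟨ r≡′ ⟩
    countBelow (f y′) (map f ys)   ∎))
    where open ≤-Reasoning

  rank-zip-sorted : ∀ {xs ys x y} → AllPairs (λ a b → f a < f b) xs → AllPairs (λ a b → f a < f b) ys →
    (x , y) ∈ₗ zip xs ys → rank xs x ≡ rank ys y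
  rank-zip-sorted {x ∷ xs} {y ∷ ys} (x<xs ∷ _) (y<ys ∷ _) (here refl) =
    trans (rank-head x<xs) (sym (rank-head y<ys))
    where
    rank-head : ∀ {z zs} → All (λ w → f z < f w) zs → rank (z ∷ zs) z ≡ 0
    rank-head {z} {zs} z<zs = trans (countBelow-∷-≮ (map f zs) (<-irrefl refl))
      (countBelow-none (map f zs) (map⁺ (All.map <⇒≤ z<zs)))
  rank-zip-sorted {x₀ ∷ xs} {y₀ ∷ ys} (x₀<xs ∷ xs<) (y₀<ys ∷ ys<) (there m) =
    trans (countBelow-∷-< (map f xs) (All.lookup x₀<xs (∈-zip⁻ˡ m)))
      (trans (cong suc (rank-zip-sorted xs< ys< m))
        (sym (countBelow-∷-< (map f ys) (All.lookup y₀<ys (∈-zip⁻ʳ m)))))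

module _ {n : ℕ} where

  deletedBelow : (Fin n → ℕ) → Subset n → ℕ → ℕ
  deletedBelow f X c = countBelow c (map f (filter (_∈? X) (allFin n)))

  deletedBelow-< : ∀ (A B : Subset n) (f : Fin n → ℕ) {a b c} → a ∈ₗ kept A →
    rank f (kept A) a ≡ rank f (kept B) b → f a < c → c ≤ f b →
    deletedBelow f A c < deletedBelow f B c
  deletedBelow-< A B f {a} {b} {c} a∈A r≡ fa<c c≤fb = +-cancelˡ-< keptA _ _ (begin-strict
    keptA + deletedBelow f A c   ≡⟨ countBelow-filter-split (_∈? A) f c (allFin n) ⟩
    countBelow c (map f (allFin n)) ≡⟨ countBelow-filter-split (_∈? B) f c (allFin n) ⟨
    keptB + deletedBelow f B c   <⟨ +-monoˡ-< (deletedBelow f B c) keptB<keptA ⟩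
    keptA + deletedBelow f B c   ∎)
    where
    open ≤-Reasoning
    keptA = countBelow c (map f (kept A))
    keptB = countBelow c (map f (kept B))
    keptB<keptA : keptB < keptA
    keptB<keptA = begin-strict
      keptB                     ≤⟨ countBelow-mono (map f (kept B)) c≤fb ⟩
      rank f (kept B) b         ≡⟨ r≡ ⟨
      rank f (kept A) a         <⟨ countBelow-mono-< (map f (kept A)) fa<c (∈-map⁺ f a∈A) ⟩
      keptA                     ∎

≡-transfer : ∀ {x x′ y y′} → (y < y′ → x < x′) → (y′ < y → x′ < x) → x ≡ x′ → y ≡ y′
≡-transfer back back′ x≡x′ =
  ≤-antisym (≮⇒≥ (<-irrefl (sym x≡x′) ∘ back′)) (≮⇒≥ (<-irrefl x≡x′ ∘ back))

common-threshold : ∀ {x y x′ y′} → x < y → x′ < y′ → x < y′ → x′ < y →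
  Σ ℕ λ c → (x < c × c ≤ y) × (x′ < c × c ≤ y′)
common-threshold {x} {x′ = x′} x<y x′<y′ x<y′ x′<y =
  suc x ⊔ suc x′ ,
  (m≤m⊔n (suc x) (suc x′) , ⊔-lub x<y x′<y) , (m≤n⊔m (suc x) (suc x′) , ⊔-lub x<y′ x′<y′)

module _ {X : Set} (f : X → ℕ) where

  Straddles : ℕ → X → X → Set
  Straddles c x y = (f x < c × c ≤ f y) ⊎ (f y < c × c ≤ f x)

  Between : X → X → X → Set
  Between x y z = (f x < f z × f z < f y) ⊎ (f y < f z × f z < f x)

  straddles-sym : ∀ {c x y} → Straddles c x y → Straddles c y x
  straddles-sym (inj₁ s) = inj₂ s
  straddles-sym (inj₂ s) = inj₁ s

  straddles-at : ∀ {x y} → f x ≢ f y → Straddles (f x) x y ⊎ Straddles (suc (f x)) x y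
  straddles-at {x} {y} fx≢fy with <-cmp (f x) (f y)
  ... | tri< fx<fy _ _ = inj₂ (inj₁ (n<1+n (f x) , fx<fy))
  ... | tri≈ _ fx≡fy _ = contradiction fx≡fy fx≢fy
  ... | tri> _ _ fy<fx = inj₁ (inj₂ (fy<fx , ≤-refl))

  between-straddles : ∀ {x y z} → Between x y z → Straddles (f z) x y × Straddles (suc (f z)) x y
  between-straddles (inj₁ (fx<fz , fz<fy)) = inj₁ (fx<fz , <⇒≤ fz<fy) , inj₁ (m<n⇒m<1+n fx<fz , fz<fy)
  between-straddles (inj₂ (fy<fz , fz<fx)) = inj₂ (fy<fz , <⇒≤ fz<fx) , inj₂ (m<n⇒m<1+n fy<fz , fz<fx)

val-injective : ∀ {n} (σ : Permutation′ n) → Injective _≡_ _≡_ (val σ)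
val-injective σ = Injection.injective (↔⇒↣ σ) ∘ toℕ-injective

edge-sym : ∀ {n} {A B : Subset n} {x y} → Edge A B x y → Edge A B y x
edge-sym (x≢y , inj₁ m) = x≢y ∘ sym , inj₂ m
edge-sym (x≢y , inj₂ m) = x≢y ∘ sym , inj₁ m

chain-path : ∀ {n} {A B : Subset n} {w x y} → InChain A B w x → InChain A B w y → Star (Edge A B) x y
chain-path wx wy = reverse edge-sym wx ◅◅ wy

module ChainGraph {n : ℕ} (A B : Subset n) where

  RanksAgree : (Fin n → ℕ) → Set
  RanksAgree f = ∀ {a b} → (a , b) ∈ₗ fulfilPairs A B → rank f (kept A) a ≡ rank f (kept B) b

  kept-sorted : (X : Subset n) → AllPairs (λ i j → toℕ i < toℕ j) (kept X)
  kept-sorted X = AllPairs.filter⁺ (λ i → ¬? (i ∈? X)) (AllPairs.tabulate⁺-< {f = λ i → i} (λ i<j → i<j))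

  positions-agree : RanksAgree toℕ
  positions-agree = rank-zip-sorted toℕ (kept-sorted A) (kept-sorted B)

  values-agree : ∀ σ → reduced σ A ≡ reduced σ B → RanksAgree (val σ)
  values-agree σ same =
    map-≡⇒zip-≡ (trans (standardise-map (kept A)) (trans same (sym (standardise-map (kept B)))))
    where
    standardise-map : ∀ xs → map (rank (val σ) xs) xs ≡ standardise (map (val σ) xs)
    standardise-map xs = map-∘ {g = λ x → countBelow x (map (val σ) xs)} {f = val σ} xs

  matching-< : ∀ {f} → RanksAgree f → ∀ {a b a′ b′} →
    (a , b) ∈ₗ fulfilPairs A B → (a′ , b′) ∈ₗ fulfilPairs A B → f a < f a′ ⇔ f b < f b′
  matching-< {f} agree m m′ = mk⇔
    (rank-<-transfer f {kept A} {kept B} (agree m) (agree m′) (∈-zip⁻ˡ m))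
    (rank-<-transfer f {kept B} {kept A} (sym (agree m)) (sym (agree m′)) (∈-zip⁻ʳ m))

  record Arc : Set where
    constructor arc
    field
      src tgt  : Fin n
      matched  : (src , tgt) ∈ₗ fulfilPairs A B
      distinct : src ≢ tgt
  open Arc public

  Endpoint : Fin n → Arc → Set
  Endpoint u e = u ≡ src e ⊎ u ≡ tgt e

  Crosses : (Fin n → ℕ) → ℕ → Arc → Set
  Crosses f c e = Straddles f c (src e) (tgt e)

  ascends : (Fin n → ℕ) → Arc → Bool
  ascends f e = does (f (src e) <? f (tgt e))

  arc-edge : (e : Arc) → Edge A B (src e) (tgt e)
  arc-edge e = distinct e , inj₁ (matched e)

  arc-tgt : ∀ {w} (e : Arc) → InChain A B w (src e) → InChain A B w (tgt e)
  arc-tgt e w→src = w→src ◅◅ (arc-edge e ◅ ε)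

  arcOf : ∀ {x z} → Edge A B x z → Arc
  arcOf (x≢z , inj₁ m) = arc _ _ m x≢z
  arcOf (x≢z , inj₂ m) = arc _ _ m (x≢z ∘ sym)

  arcOf-endpointˡ : ∀ {x z} (d : Edge A B x z) → Endpoint x (arcOf d)
  arcOf-endpointˡ (_ , inj₁ _) = inj₁ refl
  arcOf-endpointˡ (_ , inj₂ _) = inj₂ refl

  arcOf-endpointʳ : ∀ {x z} (d : Edge A B x z) → Endpoint z (arcOf d)
  arcOf-endpointʳ (_ , inj₁ _) = inj₂ refl
  arcOf-endpointʳ (_ , inj₂ _) = inj₁ refl

  arcOf-src : ∀ {x z} (d : Edge A B x z) → Star (Edge A B) x (src (arcOf d))
  arcOf-src (_ , inj₁ _) = ε
  arcOf-src d@(_ , inj₂ _) = d ◅ ε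

  arcOf-straddles : ∀ f {c x z} (d : Edge A B x z) → Straddles f c x z → Crosses f c (arcOf d)
  arcOf-straddles f (_ , inj₁ _) s = s
  arcOf-straddles f (_ , inj₂ _) s = straddles-sym f s

  ascends-shared : ∀ {u} (e e′ : Arc) → Endpoint u e → Endpoint u e′ → ascends toℕ e ≡ ascends toℕ e′
  ascends-shared e e′ (inj₁ refl) (inj₁ s≡s′) =
    cong₂ (λ x y → does (x <? y)) (cong toℕ s≡s′)
      (≡-transfer (Equivalence.from (matching-< positions-agree (matched e) (matched e′)))
                  (Equivalence.from (matching-< positions-agree (matched e′) (matched e)))
                  (cong toℕ s≡s′))
  ascends-shared e e′ (inj₂ refl) (inj₂ t≡t′) =
    cong₂ (λ x y → does (x <? y))
      (≡-transfer (Equivalence.to (matching-< positions-agree (matched e) (matched e′)))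
                  (Equivalence.to (matching-< positions-agree (matched e′) (matched e)))
                  (cong toℕ t≡t′))
      (cong toℕ t≡t′)
  ascends-shared e e′ (inj₂ refl) (inj₁ t≡s′) = begin
    does (toℕ (src e) <? toℕ (tgt e))    ≡⟨ cong (λ z → does (toℕ (src e) <? toℕ z)) t≡s′ ⟩
    does (toℕ (src e) <? toℕ (src e′))   ≡⟨ does-⇔ matching (_ <? _) (_ <? _) ⟩
    does (toℕ (tgt e) <? toℕ (tgt e′))   ≡⟨ cong (λ z → does (toℕ z <? toℕ (tgt e′))) t≡s′ ⟩
    does (toℕ (src e′) <? toℕ (tgt e′))  ∎
    where
    open ≡-Reasoning
    matching = matching-< positions-agree (matched e) (matched e′)
  ascends-shared e e′ (inj₁ refl) (inj₂ s≡t′) =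
    sym (ascends-shared e′ e (inj₂ refl) (inj₁ (sym s≡t′)))

  ascends-path : ∀ {x y} → Star (Edge A B) x y → (e e′ : Arc) → Endpoint x e → Endpoint y e′ →
    ascends toℕ e ≡ ascends toℕ e′
  ascends-path ε e e′ x∈e x∈e′ = ascends-shared e e′ x∈e x∈e′
  ascends-path (d ◅ ds) e e′ x∈e y∈e′ =
    trans (ascends-shared e (arcOf d) x∈e (arcOf-endpointˡ d))
          (ascends-path ds (arcOf d) e′ (arcOf-endpointʳ d) y∈e′)

  ascends-chain : ∀ {w} (e e′ : Arc) → InChain A B w (src e) → InChain A B w (src e′) →
    ascends toℕ e ≡ ascends toℕ e′
  ascends-chain e e′ w→e w→e′ = ascends-path (chain-path w→e w→e′) e e′ (inj₁ refl) (inj₁ refl)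

  crossings-agree : ∀ {f} → RanksAgree f → ∀ {c} (e e′ : Arc) → Crosses f c e → Crosses f c e′ →
    ascends f e ≡ ascends f e′
  crossings-agree agree e e′ (inj₁ (s<c , c≤t)) (inj₁ (s′<c , c≤t′)) =
    trans (dec-true (_ <? _) (<-≤-trans s<c c≤t)) (sym (dec-true (_ <? _) (<-≤-trans s′<c c≤t′)))
  crossings-agree agree e e′ (inj₂ (t<c , c≤s)) (inj₂ (t′<c , c≤s′)) =
    trans (dec-false (_ <? _) (<⇒≯ (<-≤-trans t<c c≤s)))
          (sym (dec-false (_ <? _) (<⇒≯ (<-≤-trans t′<c c≤s′))))
  crossings-agree {f} agree e e′ (inj₁ (s<c , c≤t)) (inj₂ (t′<c , c≤s′)) =
    contradiction (deletedBelow-< A B f (∈-zip⁻ˡ (matched e)) (agree (matched e)) s<c c≤t)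
      (<⇒≯ (deletedBelow-< B A f (∈-zip⁻ʳ (matched e′)) (sym (agree (matched e′))) t′<c c≤s′))
  crossings-agree agree e e′ s@(inj₂ _) s′@(inj₁ _) = sym (crossings-agree agree e′ e s′ s)

  straddling-arc : ∀ f {x y c} → Star (Edge A B) x y → f x < c → c ≤ f y →
    Σ Arc λ e → Star (Edge A B) x (src e) × Crosses f c e
  straddling-arc f ε fx<c c≤fx = contradiction (<-≤-trans fx<c c≤fx) (<-irrefl refl)
  straddling-arc f {c = c} (_◅_ {j = z} d ds) fx<c c≤fy with c ≤? f z
  ... | yes c≤fz = arcOf d , arcOf-src d , arcOf-straddles f d (inj₁ (fx<c , c≤fz))
  ... | no c≰fz with straddling-arc f ds (≰⇒> c≰fz) c≤fy
  ...   | e , z→e , e-crosses = e , d ◅ z→e , e-crosses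

  chain-straddled : ∀ f {w x y c} → InChain A B w x → InChain A B w y → f x < c → c ≤ f y →
    Σ Arc λ e → InChain A B w (src e) × Crosses f c e
  chain-straddled f w→x w→y fx<c c≤fy with straddling-arc f (chain-path w→x w→y) fx<c c≤fy
  ... | e , x→e , e-crosses = e , w→x ◅◅ x→e , e-crosses

  arc-at : ∀ {w q} → HasEdge A B w → InChain A B w q → Σ Arc λ e → InChain A B w (src e) × Endpoint q e
  arc-at {w} {q} (_ , d) w→q = from-path (reverse edge-sym w→q)
    where
    from-path : Star (Edge A B) q w → Σ Arc λ e → InChain A B w (src e) × Endpoint q e
    from-path ε = arcOf d , arcOf-src d , arcOf-endpointˡ d
    from-path (d′ ◅ _) = arcOf d′ , w→q ◅◅ arcOf-src d′ , arcOf-endpointˡ d′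

  crosses-at-endpoint : ∀ f → Injective _≡_ _≡_ f → ∀ (e : Arc) {q} → Endpoint q e →
    Crosses f (f q) e ⊎ Crosses f (suc (f q)) e
  crosses-at-endpoint f f-inj e (inj₁ refl) = straddles-at f (distinct e ∘ f-inj)
  crosses-at-endpoint f f-inj e (inj₂ refl) =
    Sum.map (straddles-sym f) (straddles-sym f) (straddles-at f (distinct e ∘ sym ∘ f-inj))

  shared-threshold : ∀ f → Injective _≡_ _≡_ f → ∀ (e : Arc) {q p p′} → Endpoint q e → Between f p p′ q →
    Σ ℕ λ c → Crosses f c e × Straddles f c p p′
  shared-threshold f f-inj e q∈e q-between with crosses-at-endpoint f f-inj e q∈e
  ... | inj₁ e-crosses = _ , e-crosses , proj₁ (between-straddles f q-between)
  ... | inj₂ e-crosses = _ , e-crosses , proj₂ (between-straddles f q-between)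

module IncreasingDecreasing {n : ℕ} (σ : Permutation′ n) (A B : Subset n) (same : reduced σ A ≡ reduced σ B)
  {w w′ : Fin n} (inc : Increasing σ A B w) (dec : Decreasing σ A B w′) where

  open ChainGraph A B

  leftward : (e : Arc) → ¬ toℕ (src e) < toℕ (tgt e) → toℕ (tgt e) < toℕ (src e)
  leftward e s≮t = ≤∧≢⇒< (≮⇒≥ s≮t) (distinct e ∘ sym ∘ toℕ-injective)

  ascends-increasing : ∀ e → InChain A B w (src e) → ascends (val σ) e ≡ ascends toℕ e
  ascends-increasing e w→e = by-cases (toℕ (src e) <? toℕ (tgt e))
    where
    w→e′ = arc-tgt e w→e
    by-cases : (d : Dec (toℕ (src e) < toℕ (tgt e))) → ascends (val σ) e ≡ does d
    by-cases (yes s<t) = dec-true (_ <? _) (inc _ _ w→e w→e′ (arc-edge e) s<t)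
    by-cases (no s≮t)  =
      dec-false (_ <? _) (<⇒≯ (inc _ _ w→e′ w→e (edge-sym (arc-edge e)) (leftward e s≮t)))

  ascends-decreasing : ∀ e → InChain A B w′ (src e) → ascends (val σ) e ≡ not (ascends toℕ e)
  ascends-decreasing e w′→e = by-cases (toℕ (src e) <? toℕ (tgt e))
    where
    w′→e′ = arc-tgt e w′→e
    by-cases : (d : Dec (toℕ (src e) < toℕ (tgt e))) → ascends (val σ) e ≡ not (does d)
    by-cases (yes s<t) = dec-false (_ <? _) (<⇒≯ (dec _ _ w′→e w′→e′ (arc-edge e) s<t))
    by-cases (no s≮t)  = dec-true (_ <? _) (dec _ _ w′→e′ w′→e (edge-sym (arc-edge e)) (leftward e s≮t))

  no-common-thresholds : ∀ {c c′} (e₁ e₂ f₁ f₂ : Arc) →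
    InChain A B w (src e₁) → InChain A B w (src e₂) → InChain A B w′ (src f₁) → InChain A B w′ (src f₂) →
    Crosses toℕ c e₁ → Crosses toℕ c f₁ → Crosses (val σ) c′ e₂ → Crosses (val σ) c′ f₂ → ⊥
  no-common-thresholds e₁ e₂ f₁ f₂ w→e₁ w→e₂ w′→f₁ w′→f₂ e₁-c f₁-c e₂-c′ f₂-c′ = not-¬ refl (begin
    ascends toℕ e₁        ≡⟨ ascends-chain e₁ e₂ w→e₁ w→e₂ ⟩
    ascends toℕ e₂        ≡⟨ ascends-increasing e₂ w→e₂ ⟨
    ascends (val σ) e₂    ≡⟨ crossings-agree (values-agree σ same) e₂ f₂ e₂-c′ f₂-c′ ⟩
    ascends (val σ) f₂    ≡⟨ ascends-decreasing f₂ w′→f₂ ⟩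
    not (ascends toℕ f₂)  ≡⟨ cong not (ascends-chain f₂ f₁ w′→f₂ w′→f₁) ⟩
    not (ascends toℕ f₁)  ≡⟨ cong not (crossings-agree positions-agree f₁ e₁ f₁-c e₁-c) ⟩
    not (ascends toℕ e₁)  ∎)
    where open ≡-Reasoning

  no-double-overlap : ∀ {ℓ r b t ℓ′ r′ b′ t′} →
    InChain A B w ℓ → InChain A B w r → InChain A B w b → InChain A B w t →
    InChain A B w′ ℓ′ → InChain A B w′ r′ → InChain A B w′ b′ → InChain A B w′ t′ →
    toℕ ℓ < toℕ r → val σ b < val σ t → toℕ ℓ′ < toℕ r′ → val σ b′ < val σ t′ →
    ¬ (OverlapH ℓ r ℓ′ r′ × OverlapV σ b t b′ t′)
  no-double-overlap wℓ wr wb wt w′ℓ′ w′r′ w′b′ w′t′ ℓ<r b<t ℓ′<r′ b′<t′ ((ℓ<r′ , ℓ′<r) , (b<t′ , b′<t)) =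
    let c  , (ℓ<c , c≤r) , (ℓ′<c , c≤r′)     = common-threshold ℓ<r ℓ′<r′ ℓ<r′ ℓ′<r
        c′ , (b<c′ , c′≤t) , (b′<c′ , c′≤t′) = common-threshold b<t b′<t′ b<t′ b′<t
        e₁ , w→e₁ , e₁-c  = chain-straddled toℕ wℓ wr ℓ<c c≤r
        f₁ , w′→f₁ , f₁-c = chain-straddled toℕ w′ℓ′ w′r′ ℓ′<c c≤r′
        e₂ , w→e₂ , e₂-c′  = chain-straddled (val σ) wb wt b<c′ c′≤t
        f₂ , w′→f₂ , f₂-c′ = chain-straddled (val σ) w′b′ w′t′ b′<c′ c′≤t′
    in no-common-thresholds e₁ e₂ f₁ f₂ w→e₁ w→e₂ w′→f₁ w′→f₂ e₁-c f₁-c e₂-c′ f₂-c′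

  no-double-cut : HasEdge A B w′ → ∀ {p p′ q q′} → InChain A B w p → Edge A B p p′ →
    InChain A B w′ q → InChain A B w′ q′ → ¬ (CutsH σ p p′ q × CutsV p p′ q′)
  no-double-cut w′-edge w→p d w′→q w′→q′ (q-between , q′-between) =
    let g  , w′→g  , q∈g   = arc-at w′-edge w′→q
        g′ , w′→g′ , q′∈g′ = arc-at w′-edge w′→q′
        _ , g-c′ , d-c′    = shared-threshold (val σ) (val-injective σ) g q∈g q-between
        _ , g′-c , d-c     = shared-threshold toℕ toℕ-injective g′ q′∈g′ q′-between
        w→d = w→p ◅◅ arcOf-src d
    in no-common-thresholds (arcOf d) (arcOf d) g′ g w→d w→d w′→g′ w′→g
         (arcOf-straddles toℕ d d-c) g′-c (arcOf-straddles (val σ) d d-c′) g-c′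

corollary2p19 : (n k : ℕ) (σ : Permutation′ n) (A B : Subset n) →
    ∣ A ∣ ≡ k → ∣ B ∣ ≡ k → Disjoint A B → reduced σ A ≡ reduced σ B →
    (v v′ : Fin n) → HasEdge A B v → HasEdge A B v′ →
    Increasing σ A B v → Decreasing σ A B v′ →
    ((ℓ r b t ℓ′ r′ b′ t′ : Fin n) →
      EndVertex A B v ℓ → EndVertex A B v r → toℕ ℓ < toℕ r →
      EndVertex A B v b → EndVertex A B v t → val σ b < val σ t →
      EndVertex A B v′ ℓ′ → EndVertex A B v′ r′ → toℕ ℓ′ < toℕ r′ →
      EndVertex A B v′ b′ → EndVertex A B v′ t′ → val σ b′ < val σ t′ →
      ¬ (OverlapH ℓ r ℓ′ r′ × OverlapV σ b t b′ t′))
    × ((p p′ q q′ : Fin n) →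
      InChain A B v p → InChain A B v p′ → Edge A B p p′ →
      InChain A B v′ q → InChain A B v′ q′ →
      ¬ (CutsH σ p p′ q × CutsV p p′ q′))
corollary2p19 n k σ A B _ _ _ same v v′ _ v′-edge inc dec =
  (λ { _ _ _ _ _ _ _ _ (vℓ , _) (vr , _) ℓ<r (vb , _) (vt , _) b<t (v′ℓ′ , _) (v′r′ , _) ℓ′<r′
         (v′b′ , _) (v′t′ , _) b′<t′ →
       no-double-overlap vℓ vr vb vt v′ℓ′ v′r′ v′b′ v′t′ ℓ<r b<t ℓ′<r′ b′<t′ })
  , λ _ _ _ _ vp _ d v′q v′q′ → no-double-cut v′-edge vp d v′q v′q′
  where open IncreasingDecreasing σ A B same inc dec
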